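{- The $\mathbb Q$-algebra $\mathcal I^0$ is generated by the elements $\mathbb I_c\binom{n_1,\dots,n_r}{a_1,\dots,a_r}$ with $r\ge0$, $n_i\ge1$, $c,a_i\in\mathbb Z/N\mathbb Z$: $$\mathcal I^0=\mathbb Q\Big[\mathbb I_c\binom{n_1,\dots,n_r}{a_1,\dots,a_r}\ \Big|\ r\ge0,\ n_i\ge1,\ c,a_i\in\mathbb Z/N\mathbb Z\Big].$$
   Context: Fix $N\ge1$, $\eta=e^{2\pi\sqrt{ -1}/N}$, $S=\{\eta,\eta^2,\dots,\eta^N,0\}$. $\mathcal I(S)$ is the commutative $\mathbb Q$-algebra generated by symbols $\mathbb I(b_0;b_1,\dots,b_m;b_{m+1})$ ($m\ge0$, $b_i\in S$) modulo: (i) $\mathbb I(b;c)=1$; (ii) $\mathbb I(b;b_1,\dots,b_n;c)\mathbb I(b;b_{n+1},\dots,b_{n+m};c)=\sum_\sigma\mathbb I(b;b_{\sigma^{ -1}(1)},\dots,b_{\sigma^{ -1}(n+m)};c)$, over $\sigma\in\mathfrak S_{n+m}$ with $\sigma(1)<\dots<\sigma(n)$, $\sigma(n+1)<\dots<\sigma(n+m)$; (iii) $\mathbb I(b_0;b_1,\dots,b_m;b_{m+1})=\sum_{i=0}^m\mathbb I(b_0;b_1,\dots,b_i;c)\mathbb I(c;b_{i+1},\dots,b_m;b_{m+1})$ for $c\in S$; (iv) $\mathbb I(b;b_1,\dots,b_m;b)=0$ for $m\ge1$. $\mathcal I^0$ is the quotient of $\mathcal I(S)$ by the ideal generated by $\mathbb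 I(0;0;b)$, $b\in S\setminus\{0\}$. $\mathbb I_c\binom{n_1,\dots,n_r}{a_1,\dots,a_r}$ denotes the class of $\mathbb I(0;\eta^{a_1},\{0\}^{n_1-1},\dots,\eta^{a_r},\{0\}^{n_r-1};\eta^c)$, where $\{0\}^k$ denotes $k$ consecutive entries $0$ (for $r=0$ this is $\mathbb I(0;\eta^c)=1$). -}

module Defs where

open import Data.Nat using (ℕ; zero; suc; _≤_)
open import Data.Fin using (Fin)
open import Data.Maybe using (Maybe; just; nothing)
open import Data.List using (List; []; _∷_; [_]; _++_; map; foldr; take; drop; length; upTo; replicate; concatMap)
open import Data.List.Relation.Unary.All using (All)
open import Data.Product using (_×_; _,_; proj₁; proj₂; Σ-syntax)
open import Data.Rational using (ℚ; 0ℚ; 1ℚ; -_) renaming (_+_ to _+ℚ_; _*_ to _*ℚ_)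

-- The set S = {η, η², …, η^N, 0}.  A point is either  pt a  = η^a  with
-- a ∈ Fin N ≅ ℤ/Nℤ  (so η^N = η^0 is  pt zero), or the point  zero' = 0.
S : ℕ → Set
S N = Maybe (Fin N)

pt : ∀ {N} → Fin N → S N
pt a = just a

𝟘 : ∀ {N} → S N
𝟘 = nothing

record Sym (N : ℕ) : Set where
  constructor 𝕀
  field
    start : S N
    word  : List (S N)
    end   : S N

infixl 6 _⊕_
infixl 7 _⊗_
data Expr (A : Set) : Set where
  var   : A → Expr A
  const : ℚ → Expr A
  _⊕_   : Expr A → Expr A → Expr A
  _⊗_   : Expr A → Expr A → Expr A

Σₑ : ∀ {A} → List (Expr A) → Expr A
Σₑ = foldr _⊕_ (const 0ℚ)

-- All shuffles of two words, with multiplicity (one entry per σ).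
shuffles : ∀ {A : Set} → List A → List A → List (List A)
shuffles [] ys = [ ys ]
shuffles (x ∷ xs) [] = [ x ∷ xs ]
shuffles (x ∷ xs) (y ∷ ys) =
  map (x ∷_) (shuffles xs (y ∷ ys)) ++ map (y ∷_) (shuffles (x ∷ xs) ys)

-- The congruence defining 𝓘⁰ = 𝓘(S) / (𝕀(0;0;b), b ≠ 0):
-- commutative ℚ-algebra axioms, congruence, relations (i)–(iv), and the
-- ideal generators 𝕀(0;0;b) ≈ 0.
infix 4 _≈⁰_
data _≈⁰_ {N : ℕ} : Expr (Sym N) → Expr (Sym N) → Set where
  ≈-refl  : ∀ {x} → x ≈⁰ x
  ≈-sym   : ∀ {x y} → x ≈⁰ y → y ≈⁰ x
  ≈-trans : ∀ {x y z} → x ≈⁰ y → y ≈⁰ z → x ≈⁰ z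
  ⊕-cong  : ∀ {x x' y y'} → x ≈⁰ x' → y ≈⁰ y' → x ⊕ y ≈⁰ x' ⊕ y'
  ⊗-cong  : ∀ {x x' y y'} → x ≈⁰ x' → y ≈⁰ y' → x ⊗ y ≈⁰ x' ⊗ y'
  ⊕-assoc : ∀ x y z → (x ⊕ y) ⊕ z ≈⁰ x ⊕ (y ⊕ z)
  ⊕-comm  : ∀ x y → x ⊕ y ≈⁰ y ⊕ x
  ⊕-idˡ   : ∀ x → const 0ℚ ⊕ x ≈⁰ x
  ⊕-invˡ  : ∀ x → (const (- 1ℚ) ⊗ x) ⊕ x ≈⁰ const 0ℚ
  ⊗-assoc : ∀ x y z → (x ⊗ y) ⊗ z ≈⁰ x ⊗ (y ⊗ z)
  ⊗-comm  : ∀ x y → x ⊗ y ≈⁰ y ⊗ x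
  ⊗-idˡ   : ∀ x → const 1ℚ ⊗ x ≈⁰ x
  distribˡ : ∀ x y z → x ⊗ (y ⊕ z) ≈⁰ (x ⊗ y) ⊕ (x ⊗ z)
  const-+ : ∀ p q → const (p +ℚ q) ≈⁰ const p ⊕ const q
  const-* : ∀ p q → const (p *ℚ q) ≈⁰ const p ⊗ const q
  rel-i   : ∀ b c → var (𝕀 b [] c) ≈⁰ const 1ℚ
  rel-ii  : ∀ b c u v →
            var (𝕀 b u c) ⊗ var (𝕀 b v c)
              ≈⁰ Σₑ (map (λ w → var (𝕀 b w c)) (shuffles u v))
  rel-iii : ∀ b₀ bs b₁ c →
            var (𝕀 b₀ bs b₁)
              ≈⁰ Σₑ (map (λ i → var (𝕀 b₀ (take i bs) c) ⊗ var (𝕀 c (drop i bs) b₁))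
                         (upTo (suc (length bs))))
  rel-iv  : ∀ b x bs → var (𝕀 b (x ∷ bs) b) ≈⁰ const 0ℚ
  rel-0   : ∀ a → var (𝕀 𝟘 [ 𝟘 ] (pt a)) ≈⁰ const 0ℚ

-- 𝕀_c(n₁,…,n_r ; a₁,…,a_r) given as a list of pairs (nᵢ , aᵢ):
-- 𝕀(0; η^{a₁}, {0}^{n₁-1}, …, η^{a_r}, {0}^{n_r-1}; η^c).
Iword : ∀ {N} → List (ℕ × Fin N) → List (S N)
Iword = concatMap (λ p → pt (proj₂ p) ∷ replicate (Data.Nat._∸_ (proj₁ p) 1) 𝟘)

Ic : ∀ {N} → Fin N → List (ℕ × Fin N) → Sym N
Ic c ws = 𝕀 𝟘 (Iword ws) (pt c)

data InGen {N : ℕ} : Expr (Sym N) → Set where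
  gen-const : ∀ q → InGen (const q)
  gen-⊕     : ∀ {x y} → InGen x → InGen y → InGen (x ⊕ y)
  gen-⊗     : ∀ {x y} → InGen x → InGen y → InGen (x ⊗ y)
  gen-I     : ∀ (c : Fin N) (ws : List (ℕ × Fin N)) →
              All (λ p → 1 ≤ proj₁ p) ws → InGen (var (Ic c ws))

{-# OPTIONS --safe #-}
module Submission where

-- Every symbol reduces to symbols 𝕀(0; w; η^c).  Modulo the ideal,
-- 𝕀(0;0;η^c) · 𝕀(0; 0^j v; η^c) = 0, and the shuffle product (ii) turns this
-- into (j+1) · 𝕀(0; 0^{j+1} v; η^c) plus words with only j leading zeros; since
-- j+1 is invertible in ℚ, induction on the number of leading zeros reduces
-- 𝕀(0; w; η^c) to the generators, which are exactly the 𝕀(0; w; η^c) with w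
-- free of leading zeros.  Path composition (iii) through η^a, applied to
-- 𝕀(0; w; 0) = 0, then handles 𝕀(η^a; w; 0) by induction on the length of w,
-- and composition through 0 handles 𝕀(η^a; w; η^c).

open import Defs
open import Data.Nat using (ℕ; _≤_)
open import Data.Product using (Σ-syntax; _×_)

open import Level using (0ℓ)
open import Function using (_∘_; id)
open import Data.Nat using (zero; suc; z≤n; s≤s)
open import Data.Fin using (Fin)
open import Data.Maybe using (just; nothing)
open import Data.List using (List; []; _∷_; [_]; _++_; map; take; drop; length; replicate; applyUpTo)
open import Data.List.Properties using (map-id; map-++; map-∘; map-replicate)
open import Data.List.Relation.Unary.All using (All; []; _∷_; universal)
open import Data.List.Relation.Unary.All.Properties using (map⁺; applyUpTo⁺₂)
open import Data.Product using (_,_; proj₁)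
open import Data.Rational using (ℚ; 0ℚ; 1ℚ; -_; 1/_; NonZero; NonNegative) renaming (_+_ to _+ℚ_; _*_ to _*ℚ_)
open import Data.Rational.Properties using (*-inverseˡ; nonNeg+nonNeg⇒nonNeg; pos+nonNeg⇒pos; pos⇒nonZero)
open import Relation.Binary.Bundles using (Setoid)
open import Relation.Binary.Structures using (IsEquivalence)
open import Relation.Binary.PropositionalEquality using (_≡_; refl; sym; trans; cong; cong₂; module ≡-Reasoning)
open import Algebra.Bundles using (CommutativeRing)
import Algebra.Consequences.Setoid as Consequences
import Algebra.Properties.AbelianGroup as AbelianGroupProperties
import Relation.Binary.Reasoning.Setoid as SetoidReasoning

insertionsAfterHead : {A : Set} → A → List A → List (List A)
insertionsAfterHead x [] = []
insertionsAfterHead x (y ∷ ys) = map (y ∷_) (shuffles [ x ] ys)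

shuffles-[x]-replicate : {A : Set} (x : A) (j : ℕ) (v : List A) →
  shuffles [ x ] (replicate j x ++ v)
    ≡ replicate (suc j) (replicate (suc j) x ++ v)
        ++ map (replicate j x ++_) (insertionsAfterHead x v)
shuffles-[x]-replicate x zero [] = refl
shuffles-[x]-replicate x zero (y ∷ ys) = cong ((x ∷ y ∷ ys) ∷_) (sym (map-id _))
shuffles-[x]-replicate x (suc j) v = cong ((x ∷ x ∷ replicate j x ++ v) ∷_) (begin
  map (x ∷_) (shuffles [ x ] (replicate j x ++ v))
    ≡⟨ cong (map (x ∷_)) (shuffles-[x]-replicate x j v) ⟩
  map (x ∷_) (replicate (suc j) (replicate (suc j) x ++ v) ++ later)
    ≡⟨ map-++ (x ∷_) (replicate (suc j) _) later ⟩
  map (x ∷_) (replicate (suc j) (replicate (suc j) x ++ v)) ++ map (x ∷_) later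
    ≡⟨ cong₂ _++_ (map-replicate (x ∷_) (suc j) _) (sym (map-∘ (insertionsAfterHead x v))) ⟩
  replicate (suc j) (replicate (suc (suc j)) x ++ v)
    ++ map (replicate (suc j) x ++_) (insertionsAfterHead x v) ∎)
  where
  open ≡-Reasoning
  later = map (replicate j x ++_) (insertionsAfterHead x v)

replicate-++-∷ : {A : Set} (m : ℕ) (x : A) (w : List A) →
  replicate m x ++ x ∷ w ≡ x ∷ replicate m x ++ w
replicate-++-∷ zero x w = refl
replicate-++-∷ (suc m) x w = cong (x ∷_) (replicate-++-∷ m x w)

natℚ : ℕ → ℚ
natℚ zero = 0ℚ
natℚ (suc n) = 1ℚ +ℚ natℚ n

natℚ-nonNegative : ∀ n → NonNegative (natℚ n)
natℚ-nonNegative zero = _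
natℚ-nonNegative (suc n) = nonNeg+nonNeg⇒nonNeg 1ℚ (natℚ n) {{natℚ-nonNegative n}}

natℚ-suc-nonZero : ∀ n → NonZero (natℚ (suc n))
natℚ-suc-nonZero n =
  pos⇒nonZero (natℚ (suc n)) {{pos+nonNeg⇒pos 1ℚ (natℚ n) {{natℚ-nonNegative n}}}}

module _ {N : ℕ} where

  ≈⁰-isEquivalence : IsEquivalence (_≈⁰_ {N})
  ≈⁰-isEquivalence = record { refl = ≈-refl ; sym = ≈-sym ; trans = ≈-trans }

  ≈⁰-setoid : Setoid 0ℓ 0ℓ
  ≈⁰-setoid = record { isEquivalence = ≈⁰-isEquivalence }

  open Consequences ≈⁰-setoid using (comm∧idˡ⇒id; comm∧invˡ⇒inv; comm∧distrˡ⇒distr)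
  open SetoidReasoning ≈⁰-setoid

  neg : Expr (Sym N) → Expr (Sym N)
  neg x = const (- 1ℚ) ⊗ x

  𝓘⁰-commutativeRing : CommutativeRing 0ℓ 0ℓ
  𝓘⁰-commutativeRing = record
    { _+_ = _⊕_
    ; _*_ = _⊗_
    ; -_ = neg
    ; 0# = const 0ℚ
    ; 1# = const 1ℚ
    ; isCommutativeRing = record
      { isRing = record
        { +-isAbelianGroup = record
          { isGroup = record
            { isMonoid = record
              { isSemigroup = record
                { isMagma = record { isEquivalence = ≈⁰-isEquivalence ; ∙-cong = ⊕-cong }
                ; assoc = ⊕-assoc
                }
              ; identity = comm∧idˡ⇒id ⊕-comm ⊕-idˡ
              }
            ; inverse = comm∧invˡ⇒inv ⊕-comm ⊕-invˡ
            ; ⁻¹-cong = ⊗-cong ≈-refl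
            }
          ; comm = ⊕-comm
          }
        ; *-cong = ⊗-cong
        ; *-assoc = ⊗-assoc
        ; *-identity = comm∧idˡ⇒id ⊗-comm ⊗-idˡ
        ; distrib = comm∧distrˡ⇒distr ⊕-cong ⊗-comm distribˡ
        }
      ; *-comm = ⊗-comm
      }
    }

  open CommutativeRing 𝓘⁰-commutativeRing using (zeroˡ; distribʳ; +-abelianGroup)
  open AbelianGroupProperties +-abelianGroup using (inverseˡ-unique)

  Σₑ-++ : (xs ys : List (Expr (Sym N))) → Σₑ (xs ++ ys) ≈⁰ Σₑ xs ⊕ Σₑ ys
  Σₑ-++ [] ys = ≈-sym (⊕-idˡ _)
  Σₑ-++ (x ∷ xs) ys = ≈-trans (⊕-cong ≈-refl (Σₑ-++ xs ys)) (≈-sym (⊕-assoc _ _ _))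

  Σₑ-replicate : ∀ n (x : Expr (Sym N)) → Σₑ (replicate n x) ≈⁰ const (natℚ n) ⊗ x
  Σₑ-replicate zero x = ≈-sym (zeroˡ x)
  Σₑ-replicate (suc n) x = begin
    x ⊕ Σₑ (replicate n x)                ≈⟨ ⊕-cong (≈-sym (⊗-idˡ x)) (Σₑ-replicate n x) ⟩
    (const 1ℚ ⊗ x) ⊕ (const (natℚ n) ⊗ x) ≈⟨ distribʳ x _ _ ⟨
    (const 1ℚ ⊕ const (natℚ n)) ⊗ x       ≈⟨ ⊗-cong (const-+ _ _) ≈-refl ⟨
    const (natℚ (suc n)) ⊗ x              ∎

  Generated : Expr (Sym N) → Set
  Generated x = Σ[ y ∈ Expr (Sym N) ] (InGen y × x ≈⁰ y)

  Generated-const : ∀ q → Generated (const q)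
  Generated-const q = const q , gen-const q , ≈-refl

  Generated-⊕ : ∀ {x y} → Generated x → Generated y → Generated (x ⊕ y)
  Generated-⊕ (x′ , gx , x≈x′) (y′ , gy , y≈y′) = x′ ⊕ y′ , gen-⊕ gx gy , ⊕-cong x≈x′ y≈y′

  Generated-⊗ : ∀ {x y} → Generated x → Generated y → Generated (x ⊗ y)
  Generated-⊗ (x′ , gx , x≈x′) (y′ , gy , y≈y′) = x′ ⊗ y′ , gen-⊗ gx gy , ⊗-cong x≈x′ y≈y′

  Generated-resp : ∀ {x y} → x ≈⁰ y → Generated y → Generated x
  Generated-resp x≈y (z , gz , y≈z) = z , gz , ≈-trans x≈y y≈z

  Generated-Σₑ : ∀ {xs} → All Generated xs → Generated (Σₑ xs)
  Generated-Σₑ [] = Generated-const 0ℚ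
  Generated-Σₑ (gx ∷ gxs) = Generated-⊕ gx (Generated-Σₑ gxs)

  Generated-⊕≈0 : ∀ {x y} → x ⊕ y ≈⁰ const 0ℚ → Generated y → Generated x
  Generated-⊕≈0 {x} {y} x+y≈0 gy =
    Generated-resp (inverseˡ-unique x y x+y≈0) (Generated-⊗ (Generated-const (- 1ℚ)) gy)

  Generated-Σₑ-replicate⁻¹ : ∀ n {x} → Generated (Σₑ (replicate (suc n) x)) → Generated x
  Generated-Σₑ-replicate⁻¹ n {x} g =
    Generated-resp x≈r·Σ (Generated-⊗ (Generated-const r) g)
    where
    q = natℚ (suc n)
    r = (1/ q) {{natℚ-suc-nonZero n}}
    x≈r·Σ : x ≈⁰ const r ⊗ Σₑ (replicate (suc n) x)
    x≈r·Σ = begin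
      x                                  ≈⟨ ⊗-idˡ x ⟨
      const 1ℚ ⊗ x                       ≡⟨ cong (λ p → const p ⊗ x) r*q≡1 ⟨
      const (r *ℚ q) ⊗ x                 ≈⟨ ⊗-cong (const-* r q) ≈-refl ⟩
      (const r ⊗ const q) ⊗ x            ≈⟨ ⊗-assoc _ _ _ ⟩
      const r ⊗ (const q ⊗ x)            ≈⟨ ⊗-cong ≈-refl (Σₑ-replicate (suc n) x) ⟨
      const r ⊗ Σₑ (replicate (suc n) x) ∎
      where
      r*q≡1 : r *ℚ q ≡ 1ℚ
      r*q≡1 = *-inverseˡ q {{natℚ-suc-nonZero n}}

  zeros : ℕ → List (S N)
  zeros k = replicate k 𝟘

  data NoLeadingZero : List (S N) → Set where
    [] : NoLeadingZero []
    η∷ : ∀ a w → NoLeadingZero (pt a ∷ w)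

  splitLeadingZeros : ∀ w →
    Σ[ k ∈ ℕ ] Σ[ v ∈ List (S N) ] (NoLeadingZero v × w ≡ zeros k ++ v)
  splitLeadingZeros [] = 0 , [] , [] , refl
  splitLeadingZeros (just a ∷ w) = 0 , just a ∷ w , η∷ a w , refl
  splitLeadingZeros (nothing ∷ w) with splitLeadingZeros w
  ... | k , v , nlz , w≡ = suc k , v , nlz , cong (𝟘 ∷_) w≡

  encode : Fin N → ℕ → List (S N) → List (ℕ × Fin N)
  encode a m [] = (suc m , a) ∷ []
  encode a m (nothing ∷ w) = encode a (suc m) w
  encode a m (just b ∷ w) = (suc m , a) ∷ encode b 0 w

  encode-positive : ∀ a m w → All (λ p → 1 ≤ proj₁ p) (encode a m w)
  encode-positive a m [] = s≤s z≤n ∷ []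
  encode-positive a m (nothing ∷ w) = encode-positive a (suc m) w
  encode-positive a m (just b ∷ w) = s≤s z≤n ∷ encode-positive b 0 w

  Iword-encode : ∀ a m w → Iword (encode a m w) ≡ pt a ∷ zeros m ++ w
  Iword-encode a m [] = refl
  Iword-encode a m (nothing ∷ w) =
    trans (Iword-encode a (suc m) w) (cong (pt a ∷_) (sym (replicate-++-∷ m 𝟘 w)))
  Iword-encode a m (just b ∷ w) = cong (λ u → pt a ∷ zeros m ++ u) (Iword-encode b 0 w)

  Iword-onto : ∀ {v} → NoLeadingZero v →
    Σ[ ws ∈ List (ℕ × Fin N) ] (All (λ p → 1 ≤ proj₁ p) ws × Iword ws ≡ v)
  Iword-onto [] = [] , [] , refl
  Iword-onto (η∷ a w) = encode a 0 w , encode-positive a 0 w , Iword-encode a 0 w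

  I𝟘 : Fin N → List (S N) → Expr (Sym N)
  I𝟘 c w = var (𝕀 𝟘 w (pt c))

  module _ (c : Fin N) where

    Generated-I𝟘-noLeadingZero : ∀ {v} → NoLeadingZero v → Generated (I𝟘 c v)
    Generated-I𝟘-noLeadingZero nlz with Iword-onto nlz
    ... | ws , ws-positive , refl = I𝟘 c (Iword ws) , gen-I c ws ws-positive , ≈-refl

    I𝟘-shuffle-𝟘 : ∀ j v →
      Σₑ (replicate (suc j) (I𝟘 c (zeros (suc j) ++ v)))
        ⊕ Σₑ (map (I𝟘 c) (map (zeros j ++_) (insertionsAfterHead 𝟘 v)))
        ≈⁰ const 0ℚ
    I𝟘-shuffle-𝟘 j v = begin
      Σₑ (replicate (suc j) (I𝟘 c front)) ⊕ Σₑ (map (I𝟘 c) later)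
        ≡⟨ cong (λ xs → Σₑ xs ⊕ Σₑ (map (I𝟘 c) later)) (map-replicate (I𝟘 c) (suc j) front) ⟨
      Σₑ (map (I𝟘 c) (replicate (suc j) front)) ⊕ Σₑ (map (I𝟘 c) later)
        ≈⟨ Σₑ-++ (map (I𝟘 c) (replicate (suc j) front)) _ ⟨
      Σₑ (map (I𝟘 c) (replicate (suc j) front) ++ map (I𝟘 c) later)
        ≡⟨ cong Σₑ (map-++ (I𝟘 c) (replicate (suc j) front) later) ⟨
      Σₑ (map (I𝟘 c) (replicate (suc j) front ++ later))
        ≡⟨ cong (Σₑ ∘ map (I𝟘 c)) (shuffles-[x]-replicate 𝟘 j v) ⟨
      Σₑ (map (I𝟘 c) (shuffles [ 𝟘 ] (zeros j ++ v)))
        ≈⟨ rel-ii 𝟘 (pt c) [ 𝟘 ] (zeros j ++ v) ⟨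
      I𝟘 c [ 𝟘 ] ⊗ I𝟘 c (zeros j ++ v)
        ≈⟨ ⊗-cong (rel-0 c) ≈-refl ⟩
      const 0ℚ ⊗ I𝟘 c (zeros j ++ v)
        ≈⟨ zeroˡ _ ⟩
      const 0ℚ ∎
      where
      front = zeros (suc j) ++ v
      later = map (zeros j ++_) (insertionsAfterHead 𝟘 v)

    Generated-I𝟘-zeros : ∀ k {v} → NoLeadingZero v → Generated (I𝟘 c (zeros k ++ v))
    Generated-I𝟘-zeros zero nlz = Generated-I𝟘-noLeadingZero nlz
    Generated-I𝟘-zeros (suc j) {v} nlz =
      Generated-Σₑ-replicate⁻¹ j (Generated-⊕≈0 (I𝟘-shuffle-𝟘 j v) (Generated-Σₑ (later nlz)))
      where
      later : ∀ {v} → NoLeadingZero v →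
        All Generated (map (I𝟘 c) (map (zeros j ++_) (insertionsAfterHead 𝟘 v)))
      later [] = []
      later (η∷ a w) = map⁺ (map⁺ (map⁺ (universal (λ u → Generated-I𝟘-zeros j (η∷ a u)) _)))

    Generated-I𝟘 : ∀ w → Generated (I𝟘 c w)
    Generated-I𝟘 w with splitLeadingZeros w
    ... | k , v , nlz , refl = Generated-I𝟘-zeros k nlz

  Generated-I𝟘𝟘 : ∀ w → Generated (var (𝕀 𝟘 w 𝟘))
  Generated-I𝟘𝟘 [] = Generated-resp (rel-i 𝟘 𝟘) (Generated-const 1ℚ)
  Generated-I𝟘𝟘 (x ∷ w) = Generated-resp (rel-iv 𝟘 x w) (Generated-const 0ℚ)

  -- Stated for every suffix of w: (iii) expresses 𝕀(η^a; w; 0) through the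
  -- 𝕀(η^a; drop i w; 0) with i ≥ 1.
  Generated-Iη𝟘-drop : ∀ a w i → Generated (var (𝕀 (pt a) (drop i w) 𝟘))
  Generated-Iη𝟘-drop a [] zero = Generated-resp (rel-i _ _) (Generated-const 1ℚ)
  Generated-Iη𝟘-drop a [] (suc i) = Generated-resp (rel-i _ _) (Generated-const 1ℚ)
  Generated-Iη𝟘-drop a (x ∷ w) (suc i) = Generated-Iη𝟘-drop a w i
  Generated-Iη𝟘-drop a (x ∷ w) zero =
    Generated-resp (≈-sym unit) (Generated-⊕≈0 composition
      (Generated-Σₑ (map⁺ {f = term} (applyUpTo⁺₂ suc (suc (length w)) generated-term))))
    where
    term : ℕ → Expr (Sym N)
    term i = I𝟘 a (take i (x ∷ w)) ⊗ var (𝕀 (pt a) (drop i (x ∷ w)) 𝟘)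
    generated-term : ∀ i → Generated (term (suc i))
    generated-term i =
      Generated-⊗ (Generated-I𝟘 a (take (suc i) (x ∷ w))) (Generated-Iη𝟘-drop a w i)
    composition : term 0 ⊕ Σₑ (map term (applyUpTo suc (suc (length w)))) ≈⁰ const 0ℚ
    composition = ≈-trans (≈-sym (rel-iii 𝟘 (x ∷ w) 𝟘 (pt a))) (rel-iv 𝟘 x w)
    unit : term 0 ≈⁰ var (𝕀 (pt a) (x ∷ w) 𝟘)
    unit = ≈-trans (⊗-cong (rel-i 𝟘 (pt a)) ≈-refl) (⊗-idˡ _)

  Generated-var : ∀ s → Generated (var s)
  Generated-var (𝕀 nothing w nothing) = Generated-I𝟘𝟘 w
  Generated-var (𝕀 nothing w (just c)) = Generated-I𝟘 c w
  Generated-var (𝕀 (just a) w nothing) = Generated-Iη𝟘-drop a w 0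
  Generated-var (𝕀 (just a) w (just c)) =
    Generated-resp (rel-iii (pt a) w (pt c) 𝟘)
      (Generated-Σₑ (map⁺ {f = term} (applyUpTo⁺₂ id (suc (length w)) generated-term)))
    where
    term : ℕ → Expr (Sym N)
    term i = var (𝕀 (pt a) (take i w) 𝟘) ⊗ I𝟘 c (drop i w)
    generated-term : ∀ i → Generated (term i)
    generated-term i =
      Generated-⊗ (Generated-Iη𝟘-drop a (take i w) 0) (Generated-I𝟘 c (drop i w))

  generated : ∀ x → Generated x
  generated (var s) = Generated-var s
  generated (const q) = Generated-const q
  generated (x ⊕ y) = Generated-⊕ (generated x) (generated y)
  generated (x ⊗ y) = Generated-⊗ (generated x) (generated y)

proposition4p7 : (N : ℕ) → 1 ≤ N → (x : Expr (Sym N)) →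
    Σ[ y ∈ Expr (Sym N) ] (InGen y × x ≈⁰ y)
proposition4p7 N _ = generated
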